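{- Let $n\ge1$, let $Q_n$ be the poset of noncrossing partitions of $[n]$ ordered by refinement, let $P_n$ be the poset of 132-avoiding permutations of $[n]$ ordered by descent sets, and let $f$ be the bijection defined in the context. If $x<y$ in $Q_n$, then $f(y)<f(x)$ in $P_n$. (That is, $P_n$ is coarser than the dual of $Q_n$.)
   Context: $[n]=\{1,\dots,n\}$. A partition of $[n]$ is noncrossing if there are no $a<b<c<d$ with $a,c$ in one block and $b,d$ in a different block. In $Q_n$, $\pi<\sigma$ means $\pi\neq\sigma$ and each block of $\sigma$ is a union of blocks of $\pi$. A permutation $p=p_1\cdots p_n$ of $[n]$ is 132-avoiding if there are no $i<j<k$ with $p_i<p_k<p_j$; its descent set is $D(p)=\{i\in[n-1]:p_i>p_{i+1}\}$. In $P_n$, $x<y$ means $D(x)\subsetneq D(y)$. The bijection $f$ from noncrossing partitions of $[n]$ to 132-avoiding permutations of $[n]$ is defined recursively: $f$ of the empty partition is the empty permutation; for a noncrossing partition $\pi$ of $[n]$, $n\ge1$, let $k$ be the largest element of the block containing $1$, let $\pi_1$ be the restriction of $\pi$ to $[k-1]$, and $\pi_2$ the restriction of $\pi$ to $\{k+1,\dots,n\}$ relabeled order-preservingly to $[n-k]$. Then $f(\pi)$ is the concatenation of $f(\pi_1)$ with each entry increased by $n-k$, the entry $n$, and $f(\pi_2)$. -}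

module Defs where

open import Data.Nat using (ℕ; zero; suc; _+_; _∸_; _<_; _≡ᵇ_)
open import Data.Bool using (if_then_else_)
open import Data.Fin using (Fin) renaming (_<_ to _<ᶠ_)
open import Data.Vec using (Vec; lookup; toList)
open import Data.List using (List; []; _∷_; _++_; map; take; drop; length)
open import Data.Product using (_×_; ∃)
open import Relation.Nullary using (¬_)
open import Relation.Binary.PropositionalEquality using (_≡_)

-- Set partitions of [n]
-- A partition of [n] is represented by a block-labelling: position i
-- (i : Fin n, standing for the element i+1 of [n]) carries a label, and
-- two elements lie in the same block iff their labels are equal.
-- Equality of partitions is equality of the induced equivalence relations
-- (labels themselves are irrelevant).

Partition : ℕ → Set
Partition n = Vec ℕ n

SameBlock : ∀ {n} → Partition n → Fin n → Fin n → Set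
SameBlock π i j = lookup π i ≡ lookup π j

NonCrossing : ∀ {n} → Partition n → Set
NonCrossing {n} π = ∀ (a b c d : Fin n) → a <ᶠ b → b <ᶠ c → c <ᶠ d →
  SameBlock π a c → SameBlock π b d → SameBlock π a b

SamePartition : ∀ {n} → Partition n → Partition n → Set
SamePartition {n} π σ = ∀ (i j : Fin n) →
  (SameBlock π i j → SameBlock σ i j) × (SameBlock σ i j → SameBlock π i j)

_<Q_ : ∀ {n} → Partition n → Partition n → Set
_<Q_ {n} π σ = ¬ SamePartition π σ × (∀ (i j : Fin n) → SameBlock π i j → SameBlock σ i j)

-- Descent sets of words (1-based positions):  Desc p i  iff  p_i > p_{i+1}

data Desc : List ℕ → ℕ → Set where
  here  : ∀ {x y r} → y < x → Desc (x ∷ y ∷ r) 1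
  there : ∀ {x r i} → Desc r i → Desc (x ∷ r) (suc i)

_<P_ : List ℕ → List ℕ → Set
x <P y = (∀ i → Desc x i → Desc y i) × ∃ (λ i → Desc y i × ¬ Desc x i)

-- lastOcc h t = number of entries of t up to and including the last
-- occurrence of h in t (0 if h does not occur in t).
lastOcc : ℕ → List ℕ → ℕ
lastOcc h [] = 0
lastOcc h (x ∷ t) with lastOcc h t
... | suc j = suc (suc j)
... | zero  = if x ≡ᵇ h then 1 else 0

-- For a labelled partition h ∷ t of [N] (N = 1 + length t), the block of 1
-- has largest element k = 1 + lastOcc h t; π₁ = restriction to [k-1]
-- = take (k-1) (h ∷ t), π₂ = restriction to {k+1..N} = drop (k-1) t.
-- The fuel argument only ensures termination; f uses fuel = n, which suffices
-- since both recursive calls are on strictly shorter lists.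
fAux : ℕ → List ℕ → List ℕ
fAux zero _ = []
fAux (suc fuel) [] = []
fAux (suc fuel) (h ∷ t) =
  map (_+ (N ∸ k)) (fAux fuel (take m (h ∷ t))) ++ (N ∷ fAux fuel (drop m t))
  where
    m = lastOcc h t
    k = suc m
    N = suc (length t)

fList : List ℕ → List ℕ
fList π = fAux (length π) π

f : ∀ {n} → Partition n → List ℕ
f π = fList (toList π)

{-# OPTIONS --safe #-}

-- For a noncrossing partition π, the descent set of f π consists of the i ≥ 1 such
-- that i + 1 is the least element of its block. This follows the recursion defining
-- f π = (f π₁ + (n − k)) · n · f π₂: descents inside the two parts are those of π₁
-- and π₂; the entry n creates no descent after the shifted f π₁ (where k shares the
-- block of 1) and one descent before f π₂ (where k + 1 is a block minimum, because
-- by noncrossingness no block meets both [k] and {k+1, …, n}).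
-- If π < σ, every least element of a block of σ is the least element of a block of
-- π, whence D(f σ) ⊆ D(f π). If the two sets of block minima were equal, each
-- σ-block would be the π-block of its minimum, so π = σ.

module Submission where

open import Defs
open import Data.Nat using (ℕ; zero; suc; _+_; _∸_; _≤_; _<_; z≤n; s≤s; s≤s⁻¹; _≡ᵇ_; _≟_; _<?_; compare; less; equal; greater)
open import Data.Nat.Properties
open import Data.Bool using (true; false)
open import Data.Unit using (tt)
open import Data.Empty using (⊥-elim)
open import Data.Product using (∃; _×_; _,_; proj₂)
open import Data.Sum using (inj₁; inj₂; [_,_]′)
open import Data.List using (List; []; _∷_; _++_; map; take; drop; length)
open import Data.List.Properties using (length-take; length-drop; length-map; length-++; take-take; take-[])
open import Data.List.Relation.Unary.All as All using (All; []; _∷_)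
open import Data.List.Relation.Unary.All.Properties using (++⁺; map⁺)
open import Data.List.Relation.Unary.Any using (here; there)
open import Data.List.Membership.Propositional using (_∈_; _∉_)
open import Data.List.Membership.Propositional.Properties using (∈-++⁻; ∈-++⁺ʳ)
open import Data.List.Membership.DecPropositional _≟_ using (_∈?_)
open import Data.Fin using (Fin; toℕ; fromℕ<) renaming (zero to fzero; suc to fsuc)
open import Data.Fin.Properties using (toℕ-injective; toℕ-fromℕ<; ¬∀⟶∃¬)
open import Data.Vec using (Vec; lookup; toList) renaming (_∷_ to _∷ᵛ_)
open import Data.Vec.Properties using (length-toList)
open import Function using (_∘_)
open import Function.Bundles using (_⇔_; mk⇔; Equivalence)
open import Function.Properties.Equivalence using () renaming (refl to ⇔-refl; sym to ⇔-sym; trans to ⇔-trans)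
open import Relation.Nullary using (¬_; Dec; yes; no)
open import Relation.Nullary.Decidable using (_×-dec_; ¬?; decidable-stable)
open import Relation.Binary.Definitions using (tri<; tri≈; tri>)
open import Relation.Binary.PropositionalEquality using (_≡_; refl; sym; trans; cong; cong₂; subst; module ≡-Reasoning)

private
  variable
    A : Set
    x y : A
    xs ℓ ℓ′ : List A
    i j k : ℕ

infix 4 _[_]=_

data _[_]=_ {A : Set} : List A → ℕ → A → Set where
  at-head : (x ∷ xs) [ 0 ]= x
  at-tail : xs [ i ]= y → (x ∷ xs) [ suc i ]= y

[]=-unique : xs [ i ]= x → xs [ i ]= y → x ≡ y
[]=-unique at-head     at-head     = refl
[]=-unique (at-tail p) (at-tail q) = []=-unique p q

[]=⇒∈ : xs [ i ]= x → x ∈ xs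
[]=⇒∈ at-head     = here refl
[]=⇒∈ (at-tail p) = there ([]=⇒∈ p)

∈⇒[]= : x ∈ xs → ∃ λ i → xs [ i ]= x
∈⇒[]= (here refl) = 0 , at-head
∈⇒[]= (there x∈)  = let (i , p) = ∈⇒[]= x∈ in suc i , at-tail p

[]=⇒< : xs [ i ]= x → i < length xs
[]=⇒< at-head     = s≤s z≤n
[]=⇒< (at-tail p) = s≤s ([]=⇒< p)

<⇒[]= : ∀ {xs : List A} {i} → i < length xs → ∃ λ x → xs [ i ]= x
<⇒[]= {xs = x ∷ xs} {zero}  _        = x , at-head
<⇒[]= {xs = x ∷ xs} {suc i} (s≤s i<) = let (y , p) = <⇒[]= i< in y , at-tail p

[]=-take⁻ : ∀ {m} → take m xs [ i ]= x → i < m × xs [ i ]= x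
[]=-take⁻ {xs = _ ∷ _} {m = suc m} at-head     = s≤s z≤n , at-head
[]=-take⁻ {xs = _ ∷ _} {m = suc m} (at-tail p) = let (i< , q) = []=-take⁻ p in s≤s i< , at-tail q

[]=-take⁺ : ∀ {m} → i < m → xs [ i ]= x → take m xs [ i ]= x
[]=-take⁺ {m = suc m} _        at-head     = at-head
[]=-take⁺ {m = suc m} (s≤s i<) (at-tail p) = at-tail ([]=-take⁺ i< p)

[]=-drop⁻ : ∀ k → drop k xs [ j ]= x → xs [ k + j ]= x
[]=-drop⁻ zero                p = p
[]=-drop⁻ {xs = _ ∷ _} (suc k) p = at-tail ([]=-drop⁻ k p)

[]=-drop⁺ : ∀ k → xs [ k + j ]= x → drop k xs [ j ]= x
[]=-drop⁺ zero    p           = p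
[]=-drop⁺ (suc k) (at-tail p) = []=-drop⁺ k p

take-+ : ∀ k j (xs : List A) → take (k + j) xs ≡ take k xs ++ take j (drop k xs)
take-+ zero    j xs       = refl
take-+ (suc k) j []       = sym (take-[] j)
take-+ (suc k) j (x ∷ xs) = cong (x ∷_) (take-+ k j xs)

-- Reading ℓ as a block labelling of [length ℓ] as in Defs, BlockMin ℓ i says that
-- the element i + 1 is the least of its block.
BlockMin : List A → ℕ → Set
BlockMin ℓ i = ∃ λ x → ℓ [ i ]= x × x ∉ take i ℓ

¬BlockMin-repeat : ℓ [ i ]= x → ℓ [ j ]= x → i < j → ¬ BlockMin ℓ j
¬BlockMin-repeat p q i<j (y , q′ , y∉) =
  y∉ (subst (_∈ _) ([]=-unique q q′) ([]=⇒∈ ([]=-take⁺ i<j p)))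

BlockMin-unique : BlockMin ℓ i → BlockMin ℓ j → ℓ [ i ]= x → ℓ [ j ]= x → i ≡ j
BlockMin-unique {i = i} {j = j} min-i min-j p q with <-cmp i j
... | tri< i<j _ _ = ⊥-elim (¬BlockMin-repeat p q i<j min-j)
... | tri≈ _ i≡j _ = i≡j
... | tri> _ _ j<i = ⊥-elim (¬BlockMin-repeat q p j<i min-i)

first-occurrence : ∀ {ℓ : List ℕ} {x} → x ∈ ℓ → ∃ λ i → ℓ [ i ]= x × x ∉ take i ℓ
first-occurrence {y ∷ ℓ} {x} x∈ with y ≟ x | x∈
... | yes refl | _          = 0 , at-head , λ ()
... | no y≢x   | here x≡y   = ⊥-elim (y≢x (sym x≡y))
... | no y≢x   | there x∈ℓ  =
  let (i , p , x∉) = first-occurrence x∈ℓ in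
  suc i , at-tail p , λ { (here x≡y) → y≢x (sym x≡y) ; (there x∈′) → x∉ x∈′ }

blockMin? : (ℓ : List ℕ) (i : ℕ) → Dec (BlockMin ℓ i)
blockMin? ℓ i with i <? length ℓ
... | no i≮ = no λ (_ , p , _) → i≮ ([]=⇒< p)
... | yes i< with <⇒[]= i<
...   | x , p with x ∈? take i ℓ
...     | yes x∈ = no λ (y , q , y∉) → y∉ (subst (_∈ take i ℓ) ([]=-unique p q) x∈)
...     | no x∉  = yes (x , p , x∉)

BlockMin-take : ∀ {ℓ : List A} {i m} → i < m → BlockMin (take m ℓ) i ⇔ BlockMin ℓ i
BlockMin-take {ℓ = ℓ} {i = i} {m = m} i<m = mk⇔
  (λ (x , p , x∉) → x , proj₂ ([]=-take⁻ p) , subst (x ∉_) take-i x∉)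
  (λ (x , p , x∉) → x , []=-take⁺ i<m p , subst (x ∉_) (sym take-i) x∉)
  where
  take-i : take i (take m ℓ) ≡ take i ℓ
  take-i = trans (take-take i m ℓ) (cong (λ n → take n ℓ) (m≤n⇒m⊓n≡m (<⇒≤ i<m)))

BlockMin-drop : ∀ {ℓ : List A} {j} k → (∀ {z} → z ∈ drop k ℓ → z ∉ take k ℓ) →
  BlockMin ℓ (k + j) ⇔ BlockMin (drop k ℓ) j
BlockMin-drop {ℓ = ℓ} {j = j} k disjoint = mk⇔
  (λ (x , p , x∉) → x , []=-drop⁺ k p , x∉ ∘ subst (x ∈_) (sym (take-+ k j ℓ)) ∘ ∈-++⁺ʳ (take k ℓ))
  (λ (x , p , x∉) → x , []=-drop⁻ k p ,
     [ disjoint ([]=⇒∈ p) , x∉ ]′ ∘ ∈-++⁻ (take k ℓ) ∘ subst (x ∈_) (take-+ k j ℓ))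

Desc-∷ : ∀ {x xs i} → Desc (x ∷ xs) (suc (suc i)) ⇔ Desc xs (suc i)
Desc-∷ = mk⇔ (λ { (there d) → d }) there

Desc-++ˡ : ∀ {xs ys i} → i < length xs → Desc (xs ++ ys) i ⇔ Desc xs i
Desc-++ˡ {_}           {i = zero}        _        = mk⇔ (λ ()) (λ ())
Desc-++ˡ {_ ∷ []}      {i = suc zero}    (s≤s ())
Desc-++ˡ {_ ∷ _ ∷ _}   {i = suc zero}    _        =
  mk⇔ (λ { (here lt) → here lt }) (λ { (here lt) → here lt })
Desc-++ˡ {_ ∷ _}       {i = suc (suc i)} (s≤s i<) =
  ⇔-trans Desc-∷ (⇔-trans (Desc-++ˡ i<) (⇔-sym Desc-∷))

Desc-++ʳ : ∀ xs {ys j} → Desc (xs ++ ys) (suc (length xs + j)) ⇔ Desc ys (suc j)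
Desc-++ʳ []       = ⇔-refl
Desc-++ʳ (x ∷ xs) = ⇔-trans Desc-∷ (Desc-++ʳ xs)

¬Desc-before-max : ∀ {xs y ys} → All (_< y) xs → ¬ Desc (xs ++ y ∷ ys) (length xs)
¬Desc-before-max []                    ()
¬Desc-before-max (x<y ∷ [])             (here y<x) = <-asym x<y y<x
¬Desc-before-max (_ ∷ [])               (there ())
¬Desc-before-max (_ ∷ below@(_ ∷ _))    (there d)  = ¬Desc-before-max below d

Desc-map-+ : ∀ c {xs i} → Desc (map (_+ c) xs) i ⇔ Desc xs i
Desc-map-+ c = mk⇔ shifted⇒ ⇒shifted
  where
  shifted⇒ : ∀ {xs i} → Desc (map (_+ c) xs) i → Desc xs i
  shifted⇒ {_ ∷ _ ∷ _} (here lt) = here (+-cancelʳ-< c _ _ lt)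
  shifted⇒ {_ ∷ _}     (there d) = there (shifted⇒ d)
  ⇒shifted : ∀ {xs i} → Desc xs i → Desc (map (_+ c) xs) i
  ⇒shifted (here lt) = here (+-monoˡ-< c lt)
  ⇒shifted (there d) = there (⇒shifted d)

lastOcc≤length : ∀ h t → lastOcc h t ≤ length t
lastOcc≤length h []      = z≤n
lastOcc≤length h (x ∷ t) with lastOcc h t | lastOcc≤length h t
... | suc j | j< = s≤s j<
... | zero  | _ with x ≡ᵇ h
...   | true  = s≤s z≤n
...   | false = z≤n

lastOcc-at : ∀ h t → (h ∷ t) [ lastOcc h t ]= h
lastOcc-at h []      = at-head
lastOcc-at h (x ∷ t) with lastOcc h t | lastOcc-at h t
... | suc j | at-tail p = at-tail (at-tail p)
... | zero  | _ with x ≡ᵇ h | ≡ᵇ⇒≡ x h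
...   | true  | x≡h with refl ← x≡h tt = at-tail at-head
...   | false | _   = at-head

lastOcc-last : ∀ h t → h ∉ drop (lastOcc h t) t
lastOcc-last h []      ()
lastOcc-last h (x ∷ t) with lastOcc h t | lastOcc-last h t
... | suc j | h∉ = h∉
... | zero  | h∉ with x ≡ᵇ h | ≡⇒≡ᵇ x h
...   | true  | _   = h∉
...   | false | x≢h = λ { (here h≡x) → x≢h (sym h≡x) ; (there h∈) → h∉ h∈ }

NonCrossingList : List A → Set
NonCrossingList ℓ = ∀ {a b c d x y} → a < b → b < c → c < d →
  ℓ [ a ]= x → ℓ [ c ]= x → ℓ [ b ]= y → ℓ [ d ]= y → x ≡ y

NonCrossingList-take : ∀ m → NonCrossingList ℓ → NonCrossingList (take m ℓ)
NonCrossingList-take m nc a<b b<c c<d pa pc pb pd =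
  nc a<b b<c c<d (proj₂ ([]=-take⁻ pa)) (proj₂ ([]=-take⁻ pc))
                 (proj₂ ([]=-take⁻ pb)) (proj₂ ([]=-take⁻ pd))

NonCrossingList-drop : ∀ k → NonCrossingList ℓ → NonCrossingList (drop k ℓ)
NonCrossingList-drop k nc a<b b<c c<d pa pc pb pd =
  nc (+-monoʳ-< k a<b) (+-monoʳ-< k b<c) (+-monoʳ-< k c<d)
     ([]=-drop⁻ k pa) ([]=-drop⁻ k pc) ([]=-drop⁻ k pb) ([]=-drop⁻ k pd)

-- A later element sharing a block with an element of [k] would lie in the block of 1
-- or in a block crossing it.
lastOcc-separates : ∀ {h t z} → NonCrossingList (h ∷ t) →
  z ∈ drop (lastOcc h t) t → z ∉ take (suc (lastOcc h t)) (h ∷ t)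
lastOcc-separates {h} {t} {z} nc z∈after z∈upto =
  let (j , q) = ∈⇒[]= z∈after
      (a , r) = ∈⇒[]= z∈upto
      (a<sm , p) = []=-take⁻ r
  in lastOcc-last h t (subst (_∈ _) (sym (head≡ (s≤s⁻¹ a<sm) p ([]=-drop⁻ (suc m) q))) z∈after)
  where
  m : ℕ
  m = lastOcc h t
  head≡ : ∀ {a j} → a ≤ m → (h ∷ t) [ a ]= z → (h ∷ t) [ suc m + j ]= z → h ≡ z
  head≡ {zero}  _   p _ = []=-unique at-head p
  head≡ {suc a} a≤m p q with m≤n⇒m<n∨m≡n a≤m
  ... | inj₁ a<m = nc (s≤s z≤n) a<m (s≤s (m≤m+n m _)) at-head (lastOcc-at h t) p q
  ... | inj₂ a≡m = []=-unique (lastOcc-at h t) (subst (λ i → (h ∷ t) [ i ]= z) a≡m p)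

-- For the labelling h ∷ t, m + 1 is the k of the recursion, L labels π₁ and R labels π₂.
module FirstBlock (h : ℕ) (t : List ℕ) where

  m N : ℕ
  m = lastOcc h t
  N = suc (length t)

  L R : List ℕ
  L = take m (h ∷ t)
  R = drop m t

  length-L : length L ≡ m
  length-L = trans (length-take m (h ∷ t)) (m≤n⇒m⊓n≡m (m≤n⇒m≤1+n (lastOcc≤length h t)))

  length-R≤ : length R ≤ length t
  length-R≤ = subst (_≤ length t) (sym (length-drop m t)) (m∸n≤m (length t) m)

  L-fits : ∀ {fuel} → length t ≤ fuel → length L ≤ fuel
  L-fits t≤ = subst (_≤ _) (sym length-L) (≤-trans (lastOcc≤length h t) t≤)

  R-fits : ∀ {fuel} → length t ≤ fuel → length R ≤ fuel
  R-fits t≤ = ≤-trans length-R≤ t≤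

  shift : ℕ
  shift = N ∸ suc m

  length-shifted : ∀ as → length as ≡ length L → length (map (_+ shift) as) ≡ m
  length-shifted as |as| = trans (length-map (_+ shift) as) (trans |as| length-L)

  shifted-below : ∀ {as} → All (_≤ length L) as → All (_< N) (map (_+ shift) as)
  shifted-below = map⁺ ∘ All.map below
    where
    below : ∀ {a} → a ≤ length L → a + shift < N
    below {a} a≤ = subst (a + shift <_) (m+[n∸m]≡n (s≤s (lastOcc≤length h t)))
                         (+-monoˡ-< shift (s≤s (subst (_ ≤_) length-L a≤)))

  right-below : ∀ {bs} → All (_≤ length R) bs → All (_< N) bs
  right-below = All.map (λ b≤ → s≤s (≤-trans b≤ length-R≤))

length-fAux : ∀ fuel ℓ → length ℓ ≤ fuel → length (fAux fuel ℓ) ≡ length ℓ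
length-fAux zero       []      _        = refl
length-fAux (suc fuel) []      _        = refl
length-fAux (suc fuel) (h ∷ t) (s≤s t≤) = begin
  length (map (_+ shift) fL ++ N ∷ fR)
    ≡⟨ length-++ (map (_+ shift) fL) ⟩
  length (map (_+ shift) fL) + suc (length fR)
    ≡⟨ cong₂ (λ a b → a + suc b) length-left length-right ⟩
  m + suc (length t ∸ m)
    ≡⟨ +-suc m _ ⟩
  suc (m + (length t ∸ m))
    ≡⟨ cong suc (m+[n∸m]≡n (lastOcc≤length h t)) ⟩
  N ∎
  where
  open FirstBlock h t
  open ≡-Reasoning
  fL fR : List ℕ
  fL = fAux fuel L
  fR = fAux fuel R
  length-left : length (map (_+ shift) fL) ≡ m
  length-left = length-shifted (fAux fuel L) (length-fAux fuel L (L-fits t≤))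
  length-right : length fR ≡ length t ∸ m
  length-right = trans (length-fAux fuel R (R-fits t≤)) (length-drop m t)

fAux-bounded : ∀ fuel ℓ → All (_≤ length ℓ) (fAux fuel ℓ)
fAux-bounded zero       _       = []
fAux-bounded (suc fuel) []      = []
fAux-bounded (suc fuel) (h ∷ t) =
  ++⁺ (All.map <⇒≤ (shifted-below (fAux-bounded fuel L)))
      (≤-refl ∷ All.map <⇒≤ (right-below (fAux-bounded fuel R)))
  where open FirstBlock h t

descents-∷-max : ∀ {y ys} {R : List ℕ} → All (_< y) ys → length ys ≡ length R →
  (∀ p → Desc ys (suc p) ⇔ BlockMin R (suc p)) → ∀ j → Desc (y ∷ ys) (suc j) ⇔ BlockMin R j
descents-∷-max {ys = []}    {[]}    _         _ _        zero    =
  mk⇔ (λ { (there ()) }) (λ { (_ , () , _) })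
descents-∷-max {ys = _ ∷ _} {r ∷ _} (b<y ∷ _) _ _        zero    =
  mk⇔ (λ _ → r , at-head , λ ()) (λ _ → here b<y)
descents-∷-max                      _         _ descents (suc j) = ⇔-trans Desc-∷ (descents j)

-- At position m neither side holds: the entries of as lie below y, and ℓ repeats its
-- first entry there.
descents-glue : ∀ {ℓ as bs : List ℕ} {y x} m → length as ≡ m → All (_< y) as →
  ℓ [ 0 ]= x → ℓ [ m ]= x → (∀ {z} → z ∈ drop (suc m) ℓ → z ∉ take (suc m) ℓ) →
  (∀ p → Desc as (suc p) ⇔ BlockMin (take m ℓ) (suc p)) →
  (∀ j → Desc (y ∷ bs) (suc j) ⇔ BlockMin (drop (suc m) ℓ) j) →
  ∀ p → Desc (as ++ y ∷ bs) (suc p) ⇔ BlockMin ℓ (suc p)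
descents-glue {as = as} m |as| as<y head last disjoint left right p with compare (suc p) m
... | less _ k =
  ⇔-trans (Desc-++ˡ (subst (suc p <_) (sym |as|) sp<m)) (⇔-trans (left p) (BlockMin-take sp<m))
  where
  sp<m : suc p < suc (suc p + k)
  sp<m = s≤s (m≤m+n (suc p) k)
... | equal _ =
  mk⇔ (⊥-elim ∘ ¬Desc-before-max as<y ∘ subst (Desc _) (sym |as|))
      (⊥-elim ∘ ¬BlockMin-repeat head last (s≤s z≤n))
... | greater _ j with refl ← |as| =
  ⇔-trans (Desc-++ʳ as) (⇔-trans (right j) (⇔-sym (BlockMin-drop (suc m) disjoint)))

descents-fAux : ∀ fuel ℓ → length ℓ ≤ fuel → NonCrossingList ℓ →
  ∀ p → Desc (fAux fuel ℓ) (suc p) ⇔ BlockMin ℓ (suc p)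
descents-fAux zero       []      _        _  _ = mk⇔ (λ ()) (λ { (_ , () , _) })
descents-fAux (suc fuel) []      _        _  _ = mk⇔ (λ ()) (λ { (_ , () , _) })
descents-fAux (suc fuel) (h ∷ t) (s≤s t≤) nc =
  descents-glue m (length-shifted (fAux fuel L) (length-fAux fuel L (L-fits t≤)))
    (shifted-below (fAux-bounded fuel L)) at-head (lastOcc-at h t) (lastOcc-separates nc)
    descents-left descents-right
  where
  open FirstBlock h t
  descents-left : ∀ p → Desc (map (_+ shift) (fAux fuel L)) (suc p) ⇔ BlockMin L (suc p)
  descents-left p =
    ⇔-trans (Desc-map-+ shift) (descents-fAux fuel L (L-fits t≤) (NonCrossingList-take m nc) p)
  descents-right : ∀ j → Desc (N ∷ fAux fuel R) (suc j) ⇔ BlockMin R j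
  descents-right =
    descents-∷-max (right-below (fAux-bounded fuel R)) (length-fAux fuel R (R-fits t≤))
                   (descents-fAux fuel R (R-fits t≤) (NonCrossingList-drop (suc m) nc))

-- Desc counts positions from 1 and BlockMin from 0: a descent at i corresponds to
-- the element i + 1 being a block minimum.
descents-fList : ∀ ℓ → NonCrossingList ℓ → ∀ p → Desc (fList ℓ) (suc p) ⇔ BlockMin ℓ (suc p)
descents-fList ℓ = descents-fAux (length ℓ) ℓ ≤-refl

infix 4 _⊑_

_⊑_ : List A → List A → Set
ℓ ⊑ ℓ′ = ∀ {i j x y} → ℓ [ i ]= x → ℓ [ j ]= x → ℓ′ [ i ]= y → ℓ′ [ j ]= y

⊑-BlockMin : length ℓ ≡ length ℓ′ → ℓ ⊑ ℓ′ → BlockMin ℓ′ i → BlockMin ℓ i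
⊑-BlockMin |ℓ| ℓ⊑ℓ′ min-i′@(_ , q , _) =
  let (x , p) = <⇒[]= (subst (_ <_) (sym |ℓ|) ([]=⇒< q)) in
  x , p , λ x∈ → let (a , r) = ∈⇒[]= x∈ ; (a<i , pa) = []=-take⁻ r in
                 ¬BlockMin-repeat (ℓ⊑ℓ′ p pa q) q a<i min-i′

BlockMin⊆⇒⊒ : ∀ {ℓ ℓ′ : List ℕ} → length ℓ ≡ length ℓ′ → ℓ ⊑ ℓ′ →
  (∀ p → BlockMin ℓ (suc p) → BlockMin ℓ′ (suc p)) → ℓ′ ⊑ ℓ
BlockMin⊆⇒⊒ {ℓ} {ℓ′} |ℓ| ℓ⊑ℓ′ firsts {i} {j} qi qj pi =
  let (x′ , pj) = <⇒[]= (subst (j <_) (sym |ℓ|) ([]=⇒< qj))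
      (a , pa , a∉) = first-occurrence ([]=⇒∈ pi)
      (b , pb , b∉) = first-occurrence ([]=⇒∈ pj)
      a≡b = BlockMin-unique (firsts′ (_ , pa , a∉)) (firsts′ (_ , pb , b∉))
                            (ℓ⊑ℓ′ pi pa qi) (ℓ⊑ℓ′ pj pb qj)
  in subst (ℓ [ j ]=_) ([]=-unique pb (subst (ℓ [_]= _) a≡b pa)) pj
  where
  firsts′ : ∀ {i} → BlockMin ℓ i → BlockMin ℓ′ i
  firsts′ {zero}  (_ , p , _) = let (y , q) = <⇒[]= (subst (0 <_) |ℓ| ([]=⇒< p)) in y , q , λ ()
  firsts′ {suc i} = firsts i

⋢⇒BlockMin-gap : ∀ {ℓ ℓ′ : List ℕ} → length ℓ ≡ length ℓ′ → ℓ ⊑ ℓ′ → ¬ ℓ′ ⊑ ℓ →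
  ∃ λ p → BlockMin ℓ (suc p) × ¬ BlockMin ℓ′ (suc p)
⋢⇒BlockMin-gap {ℓ} {ℓ′} |ℓ| ℓ⊑ℓ′ ℓ′⋢ℓ =
  let (k , ¬¬gap) = ¬∀⟶∃¬ (length ℓ) (¬_ ∘ Gap ∘ toℕ) (¬? ∘ gap? ∘ toℕ)
                           (ℓ′⋢ℓ ∘ BlockMin⊆⇒⊒ |ℓ| ℓ⊑ℓ′ ∘ gapless)
  in toℕ k , decidable-stable (gap? (toℕ k)) ¬¬gap
  where
  Gap : ℕ → Set
  Gap p = BlockMin ℓ (suc p) × ¬ BlockMin ℓ′ (suc p)
  gap? : ∀ p → Dec (Gap p)
  gap? p = blockMin? ℓ _ ×-dec ¬? (blockMin? ℓ′ _)
  gapless : (∀ (k : Fin (length ℓ)) → ¬ Gap (toℕ k)) →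
            ∀ p → BlockMin ℓ (suc p) → BlockMin ℓ′ (suc p)
  gapless no-gap p min@(_ , q , _) = decidable-stable (blockMin? ℓ′ _) λ ¬min′ →
    subst (¬_ ∘ Gap) (toℕ-fromℕ< p<) (no-gap (fromℕ< p<)) (min , ¬min′)
    where
    p< : p < length ℓ
    p< = <-trans (n<1+n p) ([]=⇒< q)

toList-[]= : ∀ {n} (v : Vec A n) (i : Fin n) → toList v [ toℕ i ]= lookup v i
toList-[]= (x ∷ᵛ v) fzero    = at-head
toList-[]= (x ∷ᵛ v) (fsuc i) = at-tail (toList-[]= v i)

[]=-toList : ∀ {n} (v : Vec A n) → toList v [ k ]= x → ∃ λ i → toℕ i ≡ k × lookup v i ≡ x
[]=-toList (x ∷ᵛ v) at-head     = fzero , refl , refl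
[]=-toList (x ∷ᵛ v) (at-tail p) = let (i , i≡ , x≡) = []=-toList v p in fsuc i , cong suc i≡ , x≡

NonCrossing⇒NonCrossingList : ∀ {n} (π : Partition n) → NonCrossing π → NonCrossingList (toList π)
NonCrossing⇒NonCrossingList π nc a<b b<c c<d pa pc pb pd
  with []=-toList π pa | []=-toList π pb | []=-toList π pc | []=-toList π pd
... | a , refl , refl | b , refl , refl | c , refl , πc≡ | d , refl , πd≡ =
  nc a b c d a<b b<c c<d (sym πc≡) (sym πd≡)

refines⇒⊑ : ∀ {n} (π σ : Partition n) →
  (∀ i j → SameBlock π i j → SameBlock σ i j) → toList π ⊑ toList σ
refines⇒⊑ π σ refines pi pj qi with []=-toList π pi | []=-toList π pj | []=-toList σ qi
... | i , refl , refl | j , refl , πj≡ | i′ , i′≡i , refl with refl ← toℕ-injective i′≡i =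
  subst (toList σ [ toℕ j ]=_) (sym (refines i j (sym πj≡))) (toList-[]= σ j)

⊑⇒refines : ∀ {n} (π σ : Partition n) →
  toList π ⊑ toList σ → ∀ i j → SameBlock π i j → SameBlock σ i j
⊑⇒refines π σ π⊑σ i j πi≡πj =
  []=-unique (π⊑σ (toList-[]= π i) πj=πi (toList-[]= σ i)) (toList-[]= σ j)
  where
  πj=πi : toList π [ toℕ j ]= lookup π i
  πj=πi = subst (toList π [ toℕ j ]=_) (sym πi≡πj) (toList-[]= π j)

mainTheorem2 : (n : ℕ) → 1 ≤ n → (π σ : Partition n) →
    NonCrossing π → NonCrossing σ → π <Q σ → f σ <P f π
mainTheorem2 n _ π σ ncπ ncσ (π≉σ , π≤σ) = descents-⊆ , descent-gap
  where
  open Equivalence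
  descents-π : ∀ p → Desc (f π) (suc p) ⇔ BlockMin (toList π) (suc p)
  descents-π = descents-fList (toList π) (NonCrossing⇒NonCrossingList π ncπ)
  descents-σ : ∀ p → Desc (f σ) (suc p) ⇔ BlockMin (toList σ) (suc p)
  descents-σ = descents-fList (toList σ) (NonCrossing⇒NonCrossingList σ ncσ)
  same-length : length (toList π) ≡ length (toList σ)
  same-length = trans (length-toList π) (sym (length-toList σ))
  π⊑σ : toList π ⊑ toList σ
  π⊑σ = refines⇒⊑ π σ π≤σ
  σ⋢π : ¬ toList σ ⊑ toList π
  σ⋢π σ⊑π = π≉σ λ i j → π≤σ i j , ⊑⇒refines σ π σ⊑π i j
  descents-⊆ : ∀ i → Desc (f σ) i → Desc (f π) i
  descents-⊆ zero    ()
  descents-⊆ (suc p) = from (descents-π p) ∘ ⊑-BlockMin same-length π⊑σ ∘ to (descents-σ p)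
  descent-gap : ∃ λ i → Desc (f π) i × ¬ Desc (f σ) i
  descent-gap =
    let (p , minπ , ¬minσ) = ⋢⇒BlockMin-gap same-length π⊑σ σ⋢π
    in suc p , from (descents-π p) minπ , ¬minσ ∘ to (descents-σ p)
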